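{- Let $G$ be a finite simple graph with $m$ edges. Then the minimum degree of the skeleton $\mathcal{G}(\mathcal{M}(G))$ of the matching polytope of $G$ equals $m$.
   Context: A matching of $G=(V,E)$ is a set of pairwise disjoint edges (the empty set included). For $F\subseteq E$, $\chi_F\in\mathbb{R}^E$ is the incidence vector of $F$. The matching polytope $\mathcal{M}(G)$ is the convex hull of $\{\chi_M : M \text{ a matching of } G\}$, whose vertices are exactly these vectors. The skeleton $\mathcal{G}(\mathcal{M}(G))$ is the graph whose vertices and edges are the vertices and edges (1-dimensional faces) of $\mathcal{M}(G)$.
   Formalization: The linear functionals exposing the edges (1-dimensional faces) of $\mathcal{M}(G)$ have rational coefficients, and the incidence vectors are taken in ℚ^E instead of ℝ^E. -}

module Defs where

open import Data.Nat using (ℕ; zero; suc) renaming (_≤_ to _≤ℕ_)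
open import Data.Fin using (Fin; zero; suc)
open import Data.Fin.Subset using (Subset; _∈_)
open import Data.Bool using (Bool; true; false; if_then_else_)
open import Data.Vec using (lookup)
open import Data.Rational using (ℚ; 0ℚ; 1ℚ; _+_; _*_; _≤_)
open import Data.Product using (Σ; ∃; _×_; _,_; proj₁; proj₂)
open import Data.Sum using (_⊎_)
open import Relation.Binary.PropositionalEquality using (_≡_; _≢_)
open import Function.Definitions using (Injective)

record SimpleGraph (n m : ℕ) : Set where
  field
    ends     : Fin m → Fin n × Fin n
    noLoop   : ∀ e → proj₁ (ends e) ≢ proj₂ (ends e)
    noMulti  : ∀ e f →
               (proj₁ (ends e) ≡ proj₁ (ends f) × proj₂ (ends e) ≡ proj₂ (ends f))
               ⊎ (proj₁ (ends e) ≡ proj₂ (ends f) × proj₂ (ends e) ≡ proj₁ (ends f))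
               → e ≡ f
open SimpleGraph public

Incident : ∀ {n m} → SimpleGraph n m → Fin n → Fin m → Set
Incident G v e = (v ≡ proj₁ (ends G e)) ⊎ (v ≡ proj₂ (ends G e))

IsMatching : ∀ {n m} → SimpleGraph n m → Subset m → Set
IsMatching {n} G M = ∀ e f → e ∈ M → f ∈ M → e ≢ f →
  (v : Fin n) → Incident G v e → Incident G v f → Data.Empty.⊥
  where import Data.Empty

χ : ∀ {m} → Subset m → Fin m → ℚ
χ F e = if lookup F e then 1ℚ else 0ℚ

dot : ∀ {m} → (Fin m → ℚ) → (Fin m → ℚ) → ℚ
dot {zero}  c x = 0ℚ
dot {suc m} c x = c zero * x zero + dot {m} (λ i → c (suc i)) (λ i → x (suc i))

-- Vertices of the matching polytope M(G) are the vectors χ_M (M a matching),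
-- which are pairwise distinct; we identify χ_M with M.
-- χ_M and χ_N (M ≠ N) span an edge (1-dimensional face) of M(G) iff
-- there is a linear functional c whose set of maximisers over M(G)
-- is the face conv{χ_M, χ_N}, i.e. the maximising vertices are exactly χ_M, χ_N.
Adjacent : ∀ {n m} → SimpleGraph n m → Subset m → Subset m → Set
Adjacent {n} {m} G M N =
  IsMatching G M × IsMatching G N × M ≢ N ×
  Σ (Fin m → ℚ) λ c →
    dot c (χ M) ≡ dot c (χ N) ×
    (∀ L → IsMatching G L → dot c (χ L) ≤ dot c (χ M)) ×
    (∀ L → IsMatching G L → dot c (χ L) ≡ dot c (χ M) → (L ≡ M) ⊎ (L ≡ N))

HasDegree : ∀ {n m} → SimpleGraph n m → Subset m → ℕ → Set
HasDegree {n} {m} G M k =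
  Σ (Fin k → Subset m) λ f →
    Injective _≡_ _≡_ f ×
    (∀ i → Adjacent G M (f i)) ×
    (∀ N → Adjacent G M N → ∃ λ i → f i ≡ N)

MinDegree : ∀ {n m} → SimpleGraph n m → ℕ → Set
MinDegree {n} {m} G d =
  (Σ (Subset m) λ M → IsMatching G M × HasDegree G M d) ×
  (∀ M k → IsMatching G M → HasDegree G M k → d ≤ℕ k)

{-# OPTIONS --safe #-}
-- For a matching M and an edge e, let toggle M e be M with e toggled and the other edges
-- meeting e removed. It is a neighbour of M in the skeleton: weigh the edges other than e
-- by +1 on M and -1 off M. Among matchings agreeing with M at e this is maximised exactly
-- by M, among the others exactly by toggle M e, and the weight of e is chosen to make the
-- two maxima equal. Distinct edges give distinct neighbours, so every degree is at least m.
-- The empty matching has no other neighbours: if c exhibits N as one, then each e ∈ N has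
-- c e = c·{e} ≤ c·∅ = 0 while these sum to c·N = 0, so c·{e} = c·∅ and {e} = N.
module Submission where

open import Defs
open import Data.Nat using (ℕ; zero; suc)
import Data.Nat as ℕ

open import Data.Bool using (Bool; true; false; not; _∧_; if_then_else_)
open import Data.Bool.Properties using (¬-not; not-¬; not-injective) renaming (_≟_ to _≟ᵇ_)
open import Data.Fin using (Fin; zero; suc; _≟_)
open import Data.Fin.Properties using (any?; injective⇒≤; suc-injective)
open import Data.Fin.Subset using (Subset) renaming (⊥ to ∅)
open import Data.Fin.Subset.Properties using (∉⊥; nonempty?; Empty-unique)
open import Data.Vec using (lookup; tabulate)
open import Data.Vec.Properties using (lookup∘tabulate; tabulate∘lookup; tabulate-cong; lookup-replicate; []=⇒lookup; lookup⇒[]=)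
open import Data.Vec.Functional using (updateAt)
open import Data.Vec.Functional.Properties using (updateAt-minimal)
open import Data.Rational using (ℚ; 0ℚ; 1ℚ; -_; _+_; _-_; _*_; _≤_; _<_)
open import Data.Rational.Properties
  using (≤-refl; ≤-reflexive; ≤-trans; ≤-antisym; _≤?_; ≰⇒>; <⇒≢; +-mono-≤; +-mono-<-≤; +-mono-≤-<; +-assoc; +-identityˡ; +-identityʳ; *-zeroʳ; ≤ᵇ⇒≤; module ≤-Reasoning)
open import Data.Rational.Solver using (module +-*-Solver)
open import Data.Product using (∃; _×_; _,_; proj₁; proj₂; map₂)
open import Data.Sum using (_⊎_; inj₁; inj₂; [_,_]′)
open import Function using (_∘_; id)
open import Function.Definitions using (Injective)
open import Relation.Nullary using (¬_; Dec; yes; no; does; contradiction)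
open import Relation.Nullary.Decidable using (_×-dec_; _⊎-dec_; dec-true; dec-false; decidable-stable)
open import Relation.Binary.PropositionalEquality

open +-*-Solver using (solve; _:=_; _:+_; _:-_; _:*_; con)

+-≤-equality : {p q r s : ℚ} → p ≤ q → r ≤ s → p + r ≡ q + s → p ≡ q × r ≡ s
+-≤-equality {p} {q} {r} {s} p≤q r≤s p+r≡q+s =
  tight p≤q (λ p<q → +-mono-<-≤ p<q r≤s) , tight r≤s (+-mono-≤-< p≤q)
  where
  tight : {a b : ℚ} → a ≤ b → (a < b → p + r < q + s) → a ≡ b
  tight {a} {b} a≤b strict with b ≤? a
  ... | yes b≤a = ≤-antisym a≤b b≤a
  ... | no  b≰a = contradiction p+r≡q+s (<⇒≢ (strict (≰⇒> b≰a)))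

dot-mono : ∀ {m} {c d x y : Fin m → ℚ} →
           (∀ i → c i * x i ≤ d i * y i) → dot c x ≤ dot d y
dot-mono {zero}  _ = ≤-refl
dot-mono {suc m} h = +-mono-≤ (h zero) (dot-mono (h ∘ suc))

dot-mono-equality : ∀ {m} {c d x y : Fin m → ℚ} → (∀ i → c i * x i ≤ d i * y i) →
                    dot c x ≡ dot d y → ∀ i → c i * x i ≡ d i * y i
dot-mono-equality {suc m} h eq i with +-≤-equality (h zero) (dot-mono (h ∘ suc)) eq | i
... | head-eq , _       | zero   = head-eq
... | _       , tail-eq | suc i′ = dot-mono-equality (h ∘ suc) tail-eq i′

dot-zeroʳ : ∀ {m} (c : Fin m → ℚ) {y : Fin m → ℚ} → (∀ i → y i ≡ 0ℚ) → dot c y ≡ 0ℚ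
dot-zeroʳ {zero}  c h = refl
dot-zeroʳ {suc m} c h =
  cong₂ _+_ (trans (cong (c zero *_) (h zero)) (*-zeroʳ (c zero))) (dot-zeroʳ (c ∘ suc) (h ∘ suc))

dot-single : ∀ {m} (c : Fin m → ℚ) {y : Fin m → ℚ} (e : Fin m) →
             (∀ i → i ≢ e → y i ≡ 0ℚ) → dot c y ≡ c e * y e
dot-single {suc m} c {y} zero h =
  trans (cong (c zero * y zero +_) (dot-zeroʳ (c ∘ suc) (λ i → h (suc i) λ ()))) (+-identityʳ _)
dot-single {suc m} c {y} (suc e) h =
  trans (cong₂ _+_ (trans (cong (c zero *_) (h zero λ ())) (*-zeroʳ (c zero)))
                   (dot-single (c ∘ suc) e (λ i i≢e → h (suc i) (i≢e ∘ suc-injective))))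
        (+-identityˡ _)

dot-updateAt : ∀ {m} (c x : Fin m → ℚ) (e : Fin m) (d : ℚ) →
               dot (updateAt c e (_+ d)) x ≡ dot c x + d * x e
dot-updateAt {suc m} c x zero d =
  solve 4 (λ c₀ d x₀ r → (c₀ :+ d) :* x₀ :+ r := (c₀ :* x₀ :+ r) :+ d :* x₀) refl
        (c zero) d (x zero) (dot (c ∘ suc) (x ∘ suc))
dot-updateAt {suc m} c x (suc e) d =
  trans (cong (c zero * x zero +_) (dot-updateAt (c ∘ suc) (x ∘ suc) e d))
        (sym (+-assoc (c zero * x zero) _ _))

-- Shifts c at e by (c·y - c·x) / (x e - y e); dot-equalise assumes x e - y e = ±1, its own inverse.
equalise : ∀ {m} → (Fin m → ℚ) → Fin m → (x y : Fin m → ℚ) → Fin m → ℚ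
equalise c e x y = updateAt c e (_+ (dot c y - dot c x) * (x e - y e))

dot-equalise : ∀ {m} (c : Fin m → ℚ) (e : Fin m) {x y : Fin m → ℚ} →
               (x e - y e) * (x e - y e) ≡ 1ℚ →
               dot (equalise c e x y) x ≡ dot (equalise c e x y) y
dot-equalise c e {x} {y} unit = begin
  dot (equalise c e x y) x  ≡⟨ dot-updateAt c x e D ⟩
  a + D * u                 ≡⟨ solve 4 (λ a b u v → a :+ (b :- a) :* (u :- v) :* u
                                         := a :+ (b :- a) :* (u :- v) :* v :+ (b :- a) :* ((u :- v) :* (u :- v)))
                                       refl a b u v ⟩
  a + D * v + (b - a) * ((u - v) * (u - v))
                            ≡⟨ cong (λ t → a + D * v + (b - a) * t) unit ⟩
  a + D * v + (b - a) * 1ℚ  ≡⟨ solve 4 (λ a b u v → a :+ (b :- a) :* (u :- v) :* v :+ (b :- a) :* con 1ℚ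
                                         := b :+ (b :- a) :* (u :- v) :* v)
                                       refl a b u v ⟩
  b + D * v                 ≡⟨ sym (dot-updateAt c y e D) ⟩
  dot (equalise c e x y) y  ∎
  where
  open ≡-Reasoning
  a b u v D : ℚ
  a = dot c x
  b = dot c y
  u = x e
  v = y e
  D = (b - a) * (u - v)

indicator : Bool → ℚ
indicator b = if b then 1ℚ else 0ℚ

sign : Bool → ℚ
sign true  = 1ℚ
sign false = - 1ℚ

indicator-≢ : ∀ {a b} → a ≢ b → (indicator a - indicator b) * (indicator a - indicator b) ≡ 1ℚ
indicator-≢ {true}  {true}  a≢b = contradiction refl a≢b
indicator-≢ {true}  {false} _   = refl
indicator-≢ {false} {true}  _   = refl
indicator-≢ {false} {false} a≢b = contradiction refl a≢b

sign-*-mono : ∀ s {l p} → (l ≡ s → p ≡ s) → sign s * indicator l ≤ sign s * indicator p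
sign-*-mono true  {true}  {false} h = contradiction (h refl) λ ()
sign-*-mono false {false} {true}  h = contradiction (h refl) λ ()
sign-*-mono true  {false} {true}  _ = ≤ᵇ⇒≤ _
sign-*-mono false {true}  {false} _ = ≤ᵇ⇒≤ _
sign-*-mono _     {true}  {true}  _ = ≤-refl
sign-*-mono _     {false} {false} _ = ≤-refl

sign-*-injective : ∀ s {l p} → sign s * indicator l ≡ sign s * indicator p → l ≡ p
sign-*-injective true  {true}  {true}  _ = refl
sign-*-injective false {true}  {true}  _ = refl
sign-*-injective true  {false} {false} _ = refl
sign-*-injective false {false} {false} _ = refl
sign-*-injective true  {true}  {false} ()
sign-*-injective false {true}  {false} ()
sign-*-injective true  {false} {true}  ()
sign-*-injective false {false} {true}  ()

≢⇒either-true : ∀ {a b} → a ≢ b → a ≡ true ⊎ b ≡ true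
≢⇒either-true {true}          _   = inj₁ refl
≢⇒either-true {false} {true}  _   = inj₂ refl
≢⇒either-true {false} {false} a≢b = contradiction refl a≢b

lookup-ext : ∀ {m} {A B : Subset m} → (∀ x → lookup A x ≡ lookup B x) → A ≡ B
lookup-ext {A = A} {B} h = begin
  A                    ≡⟨ sym (tabulate∘lookup A) ⟩
  tabulate (lookup A)  ≡⟨ tabulate-cong h ⟩
  tabulate (lookup B)  ≡⟨ tabulate∘lookup B ⟩
  B                    ∎
  where open ≡-Reasoning

∅-lookup : ∀ {m} (x : Fin m) → lookup ∅ x ≡ false
∅-lookup x = lookup-replicate x false

dot-χ-∅ : ∀ {m} (c : Fin m → ℚ) (e : Fin m) → dot c (χ ∅) ≡ c e * 0ℚ
dot-χ-∅ c e = trans (dot-single c e λ x _ → cong indicator (∅-lookup x)) (cong (λ b → c e * indicator b) (∅-lookup e))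

-- Off e, c·A counts |A ∩ M| - |A \ M|, which only grows as A moves towards M.
dot-χ-max : ∀ {m} (M : Subset m) {e : Fin m} {c : Fin m → ℚ} →
            (∀ x → x ≢ e → c x ≡ sign (lookup M x)) →
            ∀ {L P} → lookup L e ≡ lookup P e →
            (∀ x → x ≢ e → lookup L x ≡ lookup M x → lookup P x ≡ lookup M x) →
            dot c (χ L) ≤ dot c (χ P) × (dot c (χ L) ≡ dot c (χ P) → L ≡ P)
dot-χ-max M {e} {c} c-off {L} {P} same-at-e closer-off-e =
  dot-mono pointwise , λ eq → lookup-ext (λ x → agree x (dot-mono-equality pointwise eq x))
  where
  pointwise : ∀ x → c x * indicator (lookup L x) ≤ c x * indicator (lookup P x)
  pointwise x with x ≟ e
  ... | yes refl = ≤-reflexive (cong (λ b → c x * indicator b) same-at-e)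
  ... | no  x≢e  = subst (λ s → s * indicator (lookup L x) ≤ s * indicator (lookup P x)) (sym (c-off x x≢e))
                         (sign-*-mono (lookup M x) (closer-off-e x x≢e))
  agree : ∀ x → c x * indicator (lookup L x) ≡ c x * indicator (lookup P x) → lookup L x ≡ lookup P x
  agree x eq with x ≟ e
  ... | yes refl = same-at-e
  ... | no  x≢e  = sign-*-injective (lookup M x)
                     (subst (λ s → s * indicator (lookup L x) ≡ s * indicator (lookup P x)) (c-off x x≢e) eq)

module _ {n m : ℕ} (G : SimpleGraph n m) where

  private variable
    M L : Subset m
    e e′ x : Fin m

  ShareVertex : Fin m → Fin m → Set
  ShareVertex x y = ∃ λ v → Incident G v x × Incident G v y

  incident? : ∀ v x → Dec (Incident G v x)
  incident? v x = (v ≟ proj₁ (ends G x)) ⊎-dec (v ≟ proj₂ (ends G x))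

  shareVertex? : ∀ x y → Dec (ShareVertex x y)
  shareVertex? x y = any? λ v → incident? v x ×-dec incident? v y

  matching-≡ : IsMatching G M → lookup M x ≡ true → lookup M e ≡ true → ShareVertex x e → x ≡ e
  matching-≡ {M} {x} {e} matching x∈M e∈M (v , v∈x , v∈e) =
    decidable-stable (x ≟ e) λ x≢e → matching x e (lookup⇒[]= x M x∈M) (lookup⇒[]= e M e∈M) x≢e v v∈x v∈e

  toggledAt : Subset m → Fin m → Fin m → Bool
  toggledAt M e x = if does (x ≟ e) then not (lookup M e) else not (does (shareVertex? x e)) ∧ lookup M x

  toggle : Subset m → Fin m → Subset m
  toggle M e = tabulate (toggledAt M e)

  toggle-at : ∀ M → lookup (toggle M e) e ≡ not (lookup M e)
  toggle-at {e} M rewrite lookup∘tabulate (toggledAt M e) e | dec-true (e ≟ e) refl = refl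

  toggle-shared : ∀ M → x ≢ e → ShareVertex x e → lookup (toggle M e) x ≡ false
  toggle-shared {x} {e} M x≢e shared
    rewrite lookup∘tabulate (toggledAt M e) x | dec-false (x ≟ e) x≢e | dec-true (shareVertex? x e) shared = refl

  toggle-unshared : ∀ M → x ≢ e → ¬ ShareVertex x e → lookup (toggle M e) x ≡ lookup M x
  toggle-unshared {x} {e} M x≢e unshared
    rewrite lookup∘tabulate (toggledAt M e) x | dec-false (x ≟ e) x≢e | dec-false (shareVertex? x e) unshared = refl

  toggle-⊆ : ∀ M → x ≢ e → lookup (toggle M e) x ≡ true → lookup M x ≡ true × ¬ ShareVertex x e
  toggle-⊆ {x} {e} M x≢e x∈toggle with shareVertex? x e
  ... | yes shared   = contradiction (trans (sym (toggle-shared M x≢e shared)) x∈toggle) λ ()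
  ... | no  unshared = trans (sym (toggle-unshared M x≢e unshared)) x∈toggle , unshared

  toggle-isMatching : IsMatching G M → IsMatching G (toggle M e)
  toggle-isMatching {M} {e} matching x y x∈toggle y∈toggle x≢y v v∈x v∈y with x ≟ e | y ≟ e
  ... | yes refl | yes refl = x≢y refl
  ... | yes refl | no  y≢e  = proj₂ (toggle-⊆ M y≢e ([]=⇒lookup y∈toggle)) (v , v∈y , v∈x)
  ... | no  x≢e  | yes refl = proj₂ (toggle-⊆ M x≢e ([]=⇒lookup x∈toggle)) (v , v∈x , v∈y)
  ... | no  x≢e  | no  y≢e  =
    x≢y (matching-≡ matching (proj₁ (toggle-⊆ M x≢e ([]=⇒lookup x∈toggle)))
                             (proj₁ (toggle-⊆ M y≢e ([]=⇒lookup y∈toggle))) (v , v∈x , v∈y))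

  toggle-flips : ∀ M → lookup M e ≢ lookup (toggle M e) e
  toggle-flips M eq = not-¬ refl (trans eq (toggle-at M))

  toggle-≢ : M ≢ toggle M e
  toggle-≢ {M} {e} M≡toggle = toggle-flips M (cong (λ A → lookup A e) M≡toggle)

  toggle-≡⇒shared : ∀ M → e ≢ e′ → toggle M e ≡ toggle M e′ → lookup M e ≡ true × ShareVertex e e′
  toggle-≡⇒shared {e} {e′} M e≢e′ eq with shareVertex? e e′
  ... | yes shared   =
    not-injective (trans (sym (toggle-at M)) (trans (cong (λ A → lookup A e) eq) (toggle-shared M e≢e′ shared))) ,
    shared
  ... | no  unshared =
    contradiction (sym (trans (cong (λ A → lookup A e) eq) (toggle-unshared M e≢e′ unshared))) (toggle-flips M)

  toggle-injective : IsMatching G M → Injective _≡_ _≡_ (toggle M)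
  toggle-injective {M} matching {e} {e′} eq = decidable-stable (e ≟ e′) λ e≢e′ →
    let e∈M  , shared = toggle-≡⇒shared M e≢e′ eq
        e′∈M , _      = toggle-≡⇒shared M (e≢e′ ∘ sym) (sym eq)
    in  e≢e′ (matching-≡ matching e∈M e′∈M shared)

  toggle-keeps-agreement : IsMatching G M → IsMatching G L → lookup L e ≢ lookup M e →
                           x ≢ e → lookup L x ≡ lookup M x → lookup (toggle M e) x ≡ lookup M x
  toggle-keeps-agreement {M} {L} {e} {x} M-matching L-matching Le≢Me x≢e Lx≡Mx with shareVertex? x e
  ... | no  unshared = toggle-unshared M x≢e unshared
  ... | yes shared   = trans (toggle-shared M x≢e shared) (sym (¬-not x∉M))
    where
    x∉M : lookup M x ≢ true
    x∉M x∈M with ≢⇒either-true Le≢Me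
    ... | inj₁ e∈L = x≢e (matching-≡ L-matching (trans Lx≡Mx x∈M) e∈L shared)
    ... | inj₂ e∈M = x≢e (matching-≡ M-matching x∈M e∈M shared)

  toggle-adjacent : IsMatching G M → ∀ e → Adjacent G M (toggle M e)
  toggle-adjacent {M} matching e =
    matching , toggle-isMatching matching , toggle-≢ , c , tie ,
    (λ L L-matching → proj₁ (best L-matching)) , (λ L L-matching → proj₂ (best L-matching))
    where
    N : Subset m
    N = toggle M e

    c : Fin m → ℚ
    c = equalise (sign ∘ lookup M) e (χ M) (χ N)

    tie : dot c (χ M) ≡ dot c (χ N)
    tie = dot-equalise (sign ∘ lookup M) e (indicator-≢ (toggle-flips M))

    c-off : ∀ x → x ≢ e → c x ≡ sign (lookup M x)
    c-off x x≢e = updateAt-minimal x e (sign ∘ lookup M) x≢e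

    best : IsMatching G L → dot c (χ L) ≤ dot c (χ M) × (dot c (χ L) ≡ dot c (χ M) → L ≡ M ⊎ L ≡ N)
    best {L} L-matching with lookup L e ≟ᵇ lookup M e
    ... | yes Le≡Me = map₂ (inj₁ ∘_) (dot-χ-max M c-off Le≡Me λ _ _ _ → refl)
    ... | no  Le≢Me =
      let below-N , unique = dot-χ-max M c-off (trans (¬-not Le≢Me) (sym (toggle-at M)))
                               (λ _ → toggle-keeps-agreement matching L-matching Le≢Me)
      in  ≤-trans below-N (≤-reflexive (sym tie)) , λ eq → inj₂ (unique (trans eq tie))

  degree-≥ : ∀ {k} → IsMatching G M → HasDegree G M k → m ℕ.≤ k
  degree-≥ {M} {k} matching (f , _ , _ , covers) = injective⇒≤ {f = index} index-injective
    where
    index : Fin m → Fin k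
    index e = proj₁ (covers (toggle M e) (toggle-adjacent {M} matching e))

    index-injective : Injective _≡_ _≡_ index
    index-injective {e} {e′} eq = toggle-injective {M} matching {e} {e′} (begin
      toggle M e    ≡⟨ sym (proj₂ (covers (toggle M e) (toggle-adjacent {M} matching e))) ⟩
      f (index e)   ≡⟨ cong f eq ⟩
      f (index e′)  ≡⟨ proj₂ (covers (toggle M e′) (toggle-adjacent {M} matching e′)) ⟩
      toggle M e′   ∎)
      where open ≡-Reasoning

  ∅-isMatching : IsMatching G ∅
  ∅-isMatching x _ x∈∅ = contradiction x∈∅ ∉⊥

  toggle-∅-off : x ≢ e → lookup (toggle ∅ e) x ≡ false
  toggle-∅-off {x} {e} x≢e with shareVertex? x e
  ... | yes shared   = toggle-shared ∅ x≢e shared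
  ... | no  unshared = trans (toggle-unshared ∅ x≢e unshared) (∅-lookup x)

  dot-χ-toggle-∅ : ∀ (c : Fin m → ℚ) e → dot c (χ (toggle ∅ e)) ≡ c e * 1ℚ
  dot-χ-toggle-∅ c e =
    trans (dot-single c e λ x x≢e → cong indicator (toggle-∅-off x≢e))
          (cong (λ b → c e * indicator b) (trans (toggle-at ∅) (cong not (∅-lookup e))))

  ∅-neighbour : ∀ {N} → Adjacent G ∅ N → ∃ λ e → toggle ∅ e ≡ N
  ∅-neighbour {N} (_ , _ , ∅≢N , c , tie , ∅-max , ∅-or-N) with nonempty? N
  ... | no  N-empty   = contradiction (sym (Empty-unique N-empty)) ∅≢N
  ... | yes (e , e∈N) = e , [ (λ single≡∅ → contradiction (sym single≡∅) toggle-≢) , id ]′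
                                (∅-or-N (toggle ∅ e) (toggle-isMatching {∅} ∅-isMatching) single-max)
    where
    nonpositive : ∀ x → c x * indicator (lookup N x) ≤ c x * indicator (lookup ∅ x)
    nonpositive x rewrite ∅-lookup x with lookup N x
    ... | false = ≤-refl
    ... | true  = begin
      c x * 1ℚ                ≡⟨ dot-χ-toggle-∅ c x ⟨
      dot c (χ (toggle ∅ x))  ≤⟨ ∅-max (toggle ∅ x) (toggle-isMatching {∅} ∅-isMatching) ⟩
      dot c (χ ∅)             ≡⟨ dot-χ-∅ c x ⟩
      c x * 0ℚ                ∎
      where open ≤-Reasoning

    c-e : c e * 1ℚ ≡ c e * 0ℚ
    c-e = subst₂ (λ a b → c e * indicator a ≡ c e * indicator b) ([]=⇒lookup e∈N) (∅-lookup e)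
                 (dot-mono-equality nonpositive (sym tie) e)

    single-max : dot c (χ (toggle ∅ e)) ≡ dot c (χ ∅)
    single-max = trans (dot-χ-toggle-∅ c e) (trans c-e (sym (dot-χ-∅ c e)))

  ∅-hasDegree : HasDegree G ∅ m
  ∅-hasDegree = toggle ∅ , toggle-injective {∅} ∅-isMatching , toggle-adjacent {∅} ∅-isMatching , λ _ → ∅-neighbour

theorem3p2 : (n m : ℕ) (G : SimpleGraph n m) → MinDegree G m
theorem3p2 n m G = (∅ , ∅-isMatching G , ∅-hasDegree G) , λ _ _ → degree-≥ G
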